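{- Let $A \in \mathbb{F}_2[x]$ be nonzero with Collatz sequence $(A_j)_{j\geq 0}$ and valuations $a_{2k}, b_{2k}$, and let $m \geq 0$ be such that $a_{2k} = b_{2k} = 1$ for all $k \geq m$. Then $A_{2k+1} = 1$ for every $k \geq m$; in particular the eventual degree $\ell = \lim_k \deg(A_{2k+1})$ equals $0$, and the sequence $(A_{2k+1})_{k \geq m}$ is constant (period $1$).
   Context: A polynomial $S \in \mathbb{F}_2[x]$ is called odd if $\gcd(S, x(x+1)) = 1$. Let $M_1 = x^2+x+1$. For nonzero $S$, $val_x(S)$ and $val_{x+1}(S)$ denote the exponents of $x$ and $x+1$ in $S$. For nonzero $A \in \mathbb{F}_2[x]$ define: $A_0 = A$; for every $k \geq 0$, $a_{2k} = val_x(A_{2k})$, $b_{2k} = val_{x+1}(A_{2k})$, $A_{2k+1} = A_{2k}/(x^{a_{2k}}(x+1)^{b_{2k}})$ (odd); and $A_{2k+2} = 1 + M_1 A_{2k+1}$. -}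

module Defs where

open import Data.Bool using (Bool; true; false; if_then_else_; not; _∧_; _xor_)
open import Data.List using (List; []; _∷_; length; drop; foldr)
open import Data.Nat using (ℕ; zero; suc; _∸_)

-- Polynomials over F₂ as coefficient lists, constant term first.
-- Canonical (normalised) form: no trailing 'false' (zero polynomial = []).
Poly : Set
Poly = List Bool

cons : Bool → Poly → Poly
cons b [] = if b then true ∷ [] else []
cons b (c ∷ cs) = b ∷ c ∷ cs

norm : List Bool → Poly
norm [] = []
norm (b ∷ bs) = cons b (norm bs)

addRaw : List Bool → List Bool → List Bool
addRaw [] q = q
addRaw (a ∷ p) [] = a ∷ p
addRaw (a ∷ p) (b ∷ q) = (a xor b) ∷ addRaw p q

mulRaw : List Bool → List Bool → List Bool
mulRaw [] q = []
mulRaw (a ∷ p) q = addRaw (if a then q else []) (false ∷ mulRaw p q)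

infixl 6 _+ₚ_
infixl 7 _*ₚ_

_+ₚ_ : Poly → Poly → Poly
p +ₚ q = norm (addRaw p q)

_*ₚ_ : Poly → Poly → Poly
p *ₚ q = norm (mulRaw p q)

one : Poly
one = true ∷ []

M₁ : Poly
M₁ = true ∷ true ∷ true ∷ []

NonZeroPoly : List Bool → Set
NonZeroPoly A = norm A ≡ [] → ⊥
  where
  open import Relation.Binary.PropositionalEquality using (_≡_)
  open import Data.Empty using (⊥)

-- degree (meaningful for nonzero normalised polynomials)
deg : Poly → ℕ
deg p = length p ∸ 1

valX : Poly → ℕ
valX [] = zero
valX (false ∷ p) = suc (valX p)
valX (true ∷ p) = zero

-- S(1) ∈ F₂ ; (x+1) ∣ S iff S(1) = 0
evalAt1 : Poly → Bool
evalAt1 = foldr _xor_ false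

isNonEmpty : Poly → Bool
isNonEmpty [] = false
isNonEmpty (_ ∷ _) = true

-- exact quotient S / (x+1) (when (x+1) ∣ S): q_i = s_0 + … + s_i, i < deg S
divX1Raw : Bool → List Bool → List Bool
divX1Raw acc [] = []
divX1Raw acc (s ∷ []) = []
divX1Raw acc (s ∷ t ∷ rest) = (acc xor s) ∷ divX1Raw (acc xor s) (t ∷ rest)

divX1 : Poly → Poly
divX1 p = norm (divX1Raw false p)

-- val_{x+1}(S): exponent of (x+1) in nonzero S, by repeated exact division
-- (fuel = length S is enough, since each division lowers the degree)
valX1Fuel : ℕ → Poly → ℕ
valX1Fuel zero p = zero
valX1Fuel (suc f) p =
  if isNonEmpty p ∧ not (evalAt1 p) then suc (valX1Fuel f (divX1 p)) else zero

valX1 : Poly → ℕ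
valX1 p = valX1Fuel (length p) p

divX1Pow : ℕ → Poly → Poly
divX1Pow zero p = p
divX1Pow (suc n) p = divX1Pow n (divX1 p)

oddPart : Poly → Poly
oddPart S = divX1Pow (valX1 S) (drop (valX S) S)

-- Collatz sequence: evenSeq A k = A_{2k}, oddSeq A k = A_{2k+1}
evenSeq : List Bool → ℕ → Poly
oddSeq : List Bool → ℕ → Poly
evenSeq A zero = norm A
evenSeq A (suc k) = one +ₚ (M₁ *ₚ oddSeq A k)
oddSeq A k = oddPart (evenSeq A k)

aVal : List Bool → ℕ → ℕ
aVal A k = valX (evenSeq A k)

bVal : List Bool → ℕ → ℕ
bVal A k = valX1 (evenSeq A k)

{-# OPTIONS --safe #-}
-- For k ≥ m the valuation hypothesis says A_{2k+2} = x(x+1) A_{2k+3}, so the odd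
-- parts O_k = A_{2k+1} satisfy  x(x+1) O_{k+1} = 1 + M₁ O_k = 1 + O_k + x(x+1) O_k.
-- Multiplying by x(x+1) raises the x-adic valuation, so the n-th coefficient of O_k
-- is determined by the coefficients below n of O_k and O_{k+1}. The constant
-- sequence 1 satisfies the same recurrence, hence induction on n, simultaneously
-- for all k ≥ m, shows that every O_k has the coefficients of 1.
module Submission where

open import Defs
open import Data.Bool using (Bool; true; false; _xor_)
open import Data.Bool.Properties using (xor-identityʳ; xor-assoc)
open import Data.List using (List; []; _∷_)
open import Data.Nat using (ℕ; zero; suc; _≤_; _<_; s≤s)
open import Data.Nat.Properties
  using (suc-injective; n<1+n; m<n⇒m<1+n; m≤n⇒m≤1+n; m<1+n⇒m<n∨m≡n)
open import Data.Product using (_×_; _,_; ∃-syntax)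
open import Data.Sum using (inj₁; inj₂)
open import Function using (_∘_)
open import Relation.Binary.PropositionalEquality
  using (_≡_; _≗_; refl; sym; trans; cong; cong₂; module ≡-Reasoning)

Series : Set
Series = ℕ → Bool

infixr 5 _◂_
infixl 6 _⊕_
infixr 7 x·_ x[x+1]·_

_◂_ : Bool → Series → Series
(b ◂ f) zero    = b
(b ◂ f) (suc n) = f n

𝟘 : Series
𝟘 _ = false

_⊕_ : Series → Series → Series
(f ⊕ g) n = f n xor g n

x·_ : Series → Series
x· f = false ◂ f

x[x+1]·_ : Series → Series
x[x+1]· f = x· (f ⊕ x· f)

coeff : List Bool → Series
coeff []      = 𝟘
coeff (b ∷ p) = b ◂ coeff p

◂-cong : ∀ b {f g} → f ≗ g → b ◂ f ≗ b ◂ g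
◂-cong b f≗g zero    = refl
◂-cong b f≗g (suc n) = f≗g n

x·𝟘 : x· 𝟘 ≗ 𝟘
x·𝟘 zero    = refl
x·𝟘 (suc n) = refl

coeff-cons : ∀ b p → coeff (cons b p) ≗ coeff (b ∷ p)
coeff-cons true  []      = λ _ → refl
coeff-cons false []      = sym ∘ x·𝟘
coeff-cons b     (c ∷ p) = λ _ → refl

coeff-norm : ∀ p → coeff (norm p) ≗ coeff p
coeff-norm []      n = refl
coeff-norm (b ∷ p) n = trans (coeff-cons b (norm p) n) (◂-cong b (coeff-norm p) n)

coeff-addRaw : ∀ p q → coeff (addRaw p q) ≗ coeff p ⊕ coeff q
coeff-addRaw []      q       n       = refl
coeff-addRaw (a ∷ p) []      n       = sym (xor-identityʳ _)
coeff-addRaw (a ∷ p) (b ∷ q) zero    = refl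
coeff-addRaw (a ∷ p) (b ∷ q) (suc n) = coeff-addRaw p q n

coeff-+ₚ : ∀ p q → coeff (p +ₚ q) ≗ coeff p ⊕ coeff q
coeff-+ₚ p q n = trans (coeff-norm (addRaw p q) n) (coeff-addRaw p q n)

-- mulRaw M₁ p unfolds to p + x (p + x (p + x·0)).
coeff-M₁*ₚ : ∀ p → coeff (M₁ *ₚ p) ≗ coeff p ⊕ x[x+1]· coeff p
coeff-M₁*ₚ p n =
  trans (coeff-norm (mulRaw M₁ p) n)
        (trans (coeff-addRaw p _ n) (cong (coeff p n xor_) (◂-cong false linear n)))
  where
  constant : coeff (mulRaw (true ∷ []) p) ≗ coeff p
  constant i = trans (coeff-addRaw p _ i)
                     (trans (cong (coeff p i xor_) (x·𝟘 i)) (xor-identityʳ _))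

  linear : coeff (mulRaw (true ∷ true ∷ []) p) ≗ coeff p ⊕ x· coeff p
  linear i = trans (coeff-addRaw p _ i) (cong (coeff p i xor_) (◂-cong false constant i))

norm-ext : ∀ p q → coeff p ≗ coeff q → norm p ≡ norm q
norm-ext []      []      p≗q = refl
norm-ext []      (c ∷ q) p≗q = cong₂ cons (p≗q zero) (norm-ext [] q (p≗q ∘ suc))
norm-ext (b ∷ p) []      p≗q = cong₂ cons (p≗q zero) (norm-ext p [] (p≗q ∘ suc))
norm-ext (b ∷ p) (c ∷ q) p≗q = cong₂ cons (p≗q zero) (norm-ext p q (p≗q ∘ suc))

coeff-injective : ∀ {p q} → norm p ≡ p → norm q ≡ q → coeff p ≗ coeff q → p ≡ q
coeff-injective {p} {q} p-normal q-normal p≗q =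
  trans (sym p-normal) (trans (norm-ext p q p≗q) q-normal)

norm-cons : ∀ b p → norm (cons b p) ≡ cons b (norm p)
norm-cons true  []      = refl
norm-cons false []      = refl
norm-cons b     (c ∷ p) = refl

norm-idem : ∀ p → norm (norm p) ≡ norm p
norm-idem []      = refl
norm-idem (b ∷ p) = trans (norm-cons b (norm p)) (cong (cons b) (norm-idem p))

-- The invariant of the synthetic division: T = (x+1) q + acc.
coeff-divX1Raw : ∀ acc T → acc xor evalAt1 T ≡ false →
                 coeff T ≗ coeff (divX1Raw acc T) ⊕ coeff (acc ∷ divX1Raw acc T)
coeff-divX1Raw false []           _ zero    = refl
coeff-divX1Raw false []           _ (suc n) = refl
coeff-divX1Raw true  []           ()
coeff-divX1Raw false (false ∷ []) _ n = refl
coeff-divX1Raw true  (true ∷ [])  _ n = refl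
coeff-divX1Raw false (true ∷ [])  ()
coeff-divX1Raw true  (false ∷ []) ()
coeff-divX1Raw acc   (s ∷ t ∷ T)  h zero    = lemma acc s
  where
  lemma : ∀ a s → s ≡ (a xor s) xor a
  lemma false s     = sym (xor-identityʳ s)
  lemma true  false = refl
  lemma true  true  = refl
coeff-divX1Raw acc   (s ∷ t ∷ T)  h (suc n) =
  coeff-divX1Raw (acc xor s) (t ∷ T) (trans (xor-assoc acc s _) h) n

coeff-divX1 : ∀ T → evalAt1 T ≡ false → coeff T ≗ coeff (divX1 T) ⊕ x· coeff (divX1 T)
coeff-divX1 T T[1]≡0 n =
  trans (coeff-divX1Raw false T T[1]≡0 n)
        (sym (cong₂ _xor_ (coeff-norm q n) (◂-cong false (coeff-norm q) n)))
  where
  q : List Bool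
  q = divX1Raw false T

valuations-1⇒oddPart≡divX1 : ∀ E → valX E ≡ 1 → valX1 E ≡ 1 →
  ∃[ T ] E ≡ false ∷ T × evalAt1 T ≡ false × oddPart E ≡ divX1 T
valuations-1⇒oddPart≡divX1 []          ()
valuations-1⇒oddPart≡divX1 (true ∷ T)  ()
valuations-1⇒oddPart≡divX1 (false ∷ T) valX≡1 valX1≡1 with evalAt1 T in T[1]
valuations-1⇒oddPart≡divX1 (false ∷ T) valX≡1 () | true
... | false rewrite suc-injective valX≡1 | suc-injective valX1≡1 = T , refl , T[1] , refl

coeff-oddPart : ∀ E → valX E ≡ 1 → valX1 E ≡ 1 → coeff E ≗ x[x+1]· coeff (oddPart E)
coeff-oddPart E valX≡1 valX1≡1 with valuations-1⇒oddPart≡divX1 E valX≡1 valX1≡1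
... | T , refl , T[1]≡0 , oddPart≡ rewrite oddPart≡ = ◂-cong false (coeff-divX1 T T[1]≡0)

oddPart-normal : ∀ E → valX E ≡ 1 → valX1 E ≡ 1 → norm (oddPart E) ≡ oddPart E
oddPart-normal E valX≡1 valX1≡1 with valuations-1⇒oddPart≡divX1 E valX≡1 valX1≡1
... | T , refl , _ , oddPart≡ rewrite oddPart≡ = norm-idem (divX1Raw false T)

AgreeBelow : ℕ → Series → Series → Set
AgreeBelow n f g = ∀ i → i < n → f i ≡ g i

agreeBelow-suc : ∀ {n f g} → AgreeBelow n f g → f n ≡ g n → AgreeBelow (suc n) f g
agreeBelow-suc below at-n i i<1+n with m<1+n⇒m<n∨m≡n i<1+n
... | inj₁ i<n  = below i i<n
... | inj₂ refl = at-n

x·-causal : ∀ {n f g} → AgreeBelow n f g → (x· f) n ≡ (x· g) n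
x·-causal {zero}  _     = refl
x·-causal {suc n} below = below n (n<1+n n)

x[x+1]·-causal : ∀ {n f g} → AgreeBelow n f g → (x[x+1]· f) n ≡ (x[x+1]· g) n
x[x+1]·-causal {zero}  _     = refl
x[x+1]·-causal {suc n} below =
  cong₂ _xor_ (below n (n<1+n n)) (x·-causal (λ i → below i ∘ m<n⇒m<1+n))

xor-cancel : ∀ a b c → a ≡ b xor (c xor a) → c ≡ b
xor-cancel false false false _ = refl
xor-cancel false true  true  _ = refl
xor-cancel true  false false _ = refl
xor-cancel true  true  true  _ = refl
xor-cancel false false true  ()
xor-cancel false true  false ()
xor-cancel true  false true  ()
xor-cancel true  true  false ()

recurrence⇒≗1 : (m : ℕ) (o : ℕ → Series) →
  (∀ k → m ≤ k → x[x+1]· o (suc k) ≗ coeff one ⊕ (o k ⊕ x[x+1]· o k)) →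
  ∀ k → m ≤ k → o k ≗ coeff one
recurrence⇒≗1 m o recurrence k m≤k n = agree (suc n) k m≤k n (n<1+n n)
  where
  𝟙 : Series
  𝟙 = coeff one

  agree : ∀ n k → m ≤ k → AgreeBelow n (o k) 𝟙
  agree zero    k m≤k i ()
  agree (suc n) k m≤k = agreeBelow-suc below (xor-cancel _ _ _ (begin
      (x[x+1]· 𝟙) n
        ≡⟨ sym (x[x+1]·-causal (agree n (suc k) (m≤n⇒m≤1+n m≤k))) ⟩
      (x[x+1]· o (suc k)) n
        ≡⟨ recurrence k m≤k n ⟩
      𝟙 n xor (o k n xor (x[x+1]· o k) n)
        ≡⟨ cong (λ c → 𝟙 n xor (o k n xor c)) (x[x+1]·-causal below) ⟩
      𝟙 n xor (o k n xor (x[x+1]· 𝟙) n) ∎))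
    where
    open ≡-Reasoning
    below : AgreeBelow n (o k) 𝟙
    below = agree n k m≤k

coeff-collatzStep : ∀ p →
  coeff (one +ₚ M₁ *ₚ p) ≗ coeff one ⊕ (coeff p ⊕ x[x+1]· coeff p)
coeff-collatzStep p n =
  trans (coeff-+ₚ one (M₁ *ₚ p) n) (cong (coeff one n xor_) (coeff-M₁*ₚ p n))

proposition2p8 : (A : Poly) → NonZeroPoly A → (m : ℕ)
    → (∀ k → m ≤ k → aVal A k ≡ 1 × bVal A k ≡ 1)
    → ∀ k → m ≤ k
    → oddSeq A k ≡ one × deg (oddSeq A k) ≡ 0 × oddSeq A (suc k) ≡ oddSeq A k
proposition2p8 A _ m valuations k m≤k =
  O≡1 k m≤k , cong deg (O≡1 k m≤k) ,
  trans (O≡1 (suc k) (m≤n⇒m≤1+n m≤k)) (sym (O≡1 k m≤k))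
  where
  O : ℕ → Poly
  O = oddSeq A

  recurrence : ∀ k → m ≤ k →
    x[x+1]· coeff (O (suc k)) ≗ coeff one ⊕ (coeff (O k) ⊕ x[x+1]· coeff (O k))
  recurrence k m≤k n with valuations (suc k) (m≤n⇒m≤1+n m≤k)
  ... | a≡1 , b≡1 =
    trans (sym (coeff-oddPart (evenSeq A (suc k)) a≡1 b≡1 n)) (coeff-collatzStep (O k) n)

  O≡1 : ∀ k → m ≤ k → O k ≡ one
  O≡1 k m≤k with valuations k m≤k
  ... | a≡1 , b≡1 = coeff-injective (oddPart-normal (evenSeq A k) a≡1 b≡1) refl
                      (recurrence⇒≗1 m (coeff ∘ O) recurrence k m≤k)
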